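{- If $G$ is a connected graph and $G\in\mathfrak{T}$, then $$W_\tau(G)\leq 1+\max_{P\in\mathbf{P}}\sum_{v\in V(P)} d_G(v),$$ where $\mathbf{P}$ is the set of all shortest paths in $G$ (i.e. shortest paths between pairs of vertices of $G$) and $d_G(v)$ is the degree of $v$.
   Context: All graphs are finite, undirected, without loops or multiple edges. A total coloring of a graph $G$ is an assignment of colors to the vertices and edges of $G$ such that no two adjacent vertices, no two adjacent edges, and no vertex and an edge incident to it receive the same color. For a positive integer $t$, an interval total $t$-coloring of $G$ is a total coloring of $G$ with colors $1,2,\ldots,t$ such that each color $i\in\{1,\ldots,t\}$ is used on at least one vertex or edge, and for each vertex $v$ the set consisting of the color of $v$ and the colors of the edges incident to $v$ consists of $d_G(v)+1$ consecutive integers. $\mathfrak{T}$ is the set of graphs having an interval total $t$-coloring for some $t\geq1$, and for $G\in\mathfrak{T}$, $W_\tau(G)$ is the greatest $t$ for which $G$ has an interval total $t$-coloring. -}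

module Defs where

open import Data.Nat using (ℕ; zero; suc; _+_; _≤_; _<_)
open import Data.Bool using (Bool; true; false; if_then_else_)
open import Data.Fin using (Fin)
open import Data.List using (List; []; _∷_; length; map; allFin)
open import Data.Nat.ListAction using (sum)
open import Data.Product using (Σ; ∃; ∃-syntax; _×_; _,_)
open import Data.Sum using (_⊎_)
open import Relation.Binary.PropositionalEquality using (_≡_; _≢_)
open import Relation.Nullary using (¬_)

record Graph : Set where
  field
    n     : ℕ
    adj   : Fin n → Fin n → Bool
    sym   : ∀ u v → adj u v ≡ adj v u
    irrefl : ∀ v → adj v v ≡ false

open Graph public

deg : (G : Graph) → Fin (n G) → ℕ
deg G v = sum (map (λ u → if adj G v u then 1 else 0) (allFin (n G)))

data IsWalk (G : Graph) : Fin (n G) → Fin (n G) → List (Fin (n G)) → Set where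
  single : ∀ v → IsWalk G v v (v ∷ [])
  cons   : ∀ {u w v ps} → adj G u w ≡ true → IsWalk G w v ps → IsWalk G u v (u ∷ ps)

Connected : Graph → Set
Connected G = ∀ u v → ∃[ ps ] IsWalk G u v ps

-- ps is a shortest path from u to v: a walk from u to v with no
-- strictly shorter walk from u to v (hence its vertices are distinct).
IsShortestPath : (G : Graph) → Fin (n G) → Fin (n G) → List (Fin (n G)) → Set
IsShortestPath G u v ps =
  IsWalk G u v ps × (∀ qs → IsWalk G u v qs → length ps ≤ length qs)

degSum : (G : Graph) → List (Fin (n G)) → ℕ
degSum G ps = sum (map (deg G) ps)

record TotalColouring (G : Graph) : Set where
  field
    vcol : Fin (n G) → ℕ
    ecol : Fin (n G) → Fin (n G) → ℕ   -- colour of edge uv (meaningful when adjacent)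
    ecol-sym : ∀ u v → ecol u v ≡ ecol v u

open TotalColouring public

InSpectrum : (G : Graph) → TotalColouring G → Fin (n G) → ℕ → Set
InSpectrum G c v k = (vcol c v ≡ k) ⊎ (∃[ u ] (adj G v u ≡ true × ecol c v u ≡ k))

IsIntervalTotalColouring : (G : Graph) → ℕ → TotalColouring G → Set
IsIntervalTotalColouring G t c =
  (∀ u v → adj G u v ≡ true → vcol c u ≢ vcol c v) ×
  (∀ v u w → adj G v u ≡ true → adj G v w ≡ true → u ≢ w → ecol c v u ≢ ecol c v w) ×
  (∀ v u → adj G v u ≡ true → vcol c v ≢ ecol c v u) ×
  (∀ v → 1 ≤ vcol c v × vcol c v ≤ t) ×
  (∀ u v → adj G u v ≡ true → 1 ≤ ecol c u v × ecol c u v ≤ t) ×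
  (∀ i → 1 ≤ i → i ≤ t →
     (∃[ v ] vcol c v ≡ i) ⊎ (∃[ u ] ∃[ v ] (adj G u v ≡ true × ecol c u v ≡ i))) ×
  (∀ v → ∃[ a ] (∀ k → (InSpectrum G c v k → a ≤ k × k ≤ a + deg G v)
                      × (a ≤ k → k ≤ a + deg G v → InSpectrum G c v k)))

HasIntervalTotalColouring : Graph → ℕ → Set
HasIntervalTotalColouring G t = 1 ≤ t × ∃[ c ] IsIntervalTotalColouring G t c

-- Colour 1 lies in the spectrum of some vertex u and colour t in
-- that of some vertex v. The spectrum of a vertex w is an interval of length
-- deg w, and consecutive vertices of a walk share the colour of the edge
-- between them, so along any walk from u to v the largest reachable colour
-- grows by at most the degree of each vertex visited. Applying this to a
-- shortest u–v path, which exists by connectivity, gives t ≤ 1 + degSum.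
module Submission where

open import Defs
open import Data.Nat using (ℕ; zero; suc; pred; _+_; _≤_; _<_)
open import Data.Nat.Properties
  using (module ≤-Reasoning; ≤-refl; ≤-trans; +-monoˡ-≤; +-assoc; +-identityʳ; ≮⇒≥; anyUpTo?)
open import Data.Nat.Induction using (<-rec)
open import Data.Bool using (true)
open import Data.Bool.Properties using () renaming (_≟_ to _≟ᵇ_)
open import Data.Fin using (Fin)
open import Data.Fin.Properties using (any?) renaming (_≟_ to _≟ᶠ_)
open import Data.List using ([]; _∷_; length)
open import Data.Product using (∃-syntax; _×_; _,_; proj₁; proj₂)
open import Data.Sum using (_⊎_; inj₁; inj₂)
open import Relation.Nullary using (Dec; yes; no)
open import Relation.Nullary.Decidable using (map′; _×-dec_)
open import Relation.Unary using (Pred; Decidable)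
open import Relation.Binary.PropositionalEquality using (_≡_; refl; cong; trans)

least-witness : ∀ {p} {P : Pred ℕ p} → Decidable P →
                ∀ n → P n → ∃[ m ] (P m × ∀ k → P k → m ≤ k)
least-witness {P = P} P? = <-rec (λ n → P n → ∃[ m ] (P m × ∀ k → P k → m ≤ k)) step
  where
  step : ∀ n → (∀ {m} → m < n → P m → ∃[ m′ ] (P m′ × ∀ k → P k → m′ ≤ k)) →
         P n → ∃[ m ] (P m × ∀ k → P k → m ≤ k)
  step n smaller Pn with anyUpTo? P? n
  ... | yes (m , m<n , Pm) = smaller m<n Pm
  ... | no none            = n , Pn , λ k Pk → ≮⇒≥ (λ k<n → none (k , k<n , Pk))

module _ (G : Graph) where

  HasWalkOfLength : Fin (n G) → Fin (n G) → ℕ → Set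
  HasWalkOfLength u v m = ∃[ ps ] (IsWalk G u v ps × length ps ≡ m)

  hasWalkOfLength? : ∀ m u v → Dec (HasWalkOfLength u v m)
  hasWalkOfLength? zero u v = no λ { (_ , single _ , ()) ; (_ , cons _ _ , ()) }
  hasWalkOfLength? (suc zero) u v = map′ trivial fromTrivial (u ≟ᶠ v)
    where
    trivial : u ≡ v → HasWalkOfLength u v 1
    trivial refl = _ , single u , refl
    fromTrivial : HasWalkOfLength u v 1 → u ≡ v
    fromTrivial (_ , single _ , _)              = refl
    fromTrivial (_ , cons _ (single _) , ())
    fromTrivial (_ , cons _ (cons _ _) , ())
  hasWalkOfLength? (suc (suc m)) u v =
    map′ extend firstStep
      (any? λ w → (adj G u w ≟ᵇ true) ×-dec hasWalkOfLength? (suc m) w v)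
    where
    extend : ∃[ w ] (adj G u w ≡ true × HasWalkOfLength w v (suc m)) →
             HasWalkOfLength u v (suc (suc m))
    extend (_ , uw , _ , walk , len) = _ , cons uw walk , cong suc len
    firstStep : HasWalkOfLength u v (suc (suc m)) →
                ∃[ w ] (adj G u w ≡ true × HasWalkOfLength w v (suc m))
    firstStep (_ , cons {w = w} uw walk , len) = w , uw , _ , walk , cong pred len

  walk⇒shortestPath : ∀ {u v ps} → IsWalk G u v ps → ∃[ qs ] IsShortestPath G u v qs
  walk⇒shortestPath {u} {v} {ps} walk
    with least-witness (λ m → hasWalkOfLength? m u v) (length ps) (ps , walk , refl)
  ... | _ , (qs , qsWalk , refl) , minimal =
    qs , qsWalk , λ rs rsWalk → minimal (length rs) (rs , rsWalk , refl)

  connected⇒shortestPath : Connected G → ∀ u v → ∃[ ps ] IsShortestPath G u v ps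
  connected⇒shortestPath conn u v = walk⇒shortestPath (proj₂ (conn u v))

  module _ (c : TotalColouring G) where

    SpectrumIsInterval : Fin (n G) → Set
    SpectrumIsInterval v =
      ∃[ a ] (∀ k → (InSpectrum G c v k → a ≤ k × k ≤ a + deg G v)
                  × (a ≤ k → k ≤ a + deg G v → InSpectrum G c v k))

    spectrum-spread : ∀ {v} → SpectrumIsInterval v → ∀ {k k′} →
                      InSpectrum G c v k → InSpectrum G c v k′ → k′ ≤ k + deg G v
    spectrum-spread (a , interval) {k} {k′} k∈ k′∈ =
      ≤-trans (proj₂ (proj₁ (interval k′) k′∈))
              (+-monoˡ-≤ (deg G _) (proj₁ (proj₁ (interval k) k∈)))

    colourUsed⇒inSpectrum : ∀ {i} →
      (∃[ v ] vcol c v ≡ i) ⊎ (∃[ u ] ∃[ v ] (adj G u v ≡ true × ecol c u v ≡ i)) →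
      ∃[ v ] InSpectrum G c v i
    colourUsed⇒inSpectrum (inj₁ (v , vcol≡i))          = v , inj₁ vcol≡i
    colourUsed⇒inSpectrum (inj₂ (u , v , uv , ecol≡i)) = u , inj₂ (v , uv , ecol≡i)

    -- The colour of an edge uw lies in the spectra of both u and w.
    walk-spectrum-bound : (∀ v → SpectrumIsInterval v) → ∀ {u v ps} → IsWalk G u v ps →
                          ∀ {k k′} → InSpectrum G c u k → InSpectrum G c v k′ →
                          k′ ≤ k + degSum G ps
    walk-spectrum-bound intervals (single v) {k} {k′} k∈ k′∈ = begin
      k′                    ≤⟨ spectrum-spread (intervals v) k∈ k′∈ ⟩
      k + deg G v           ≡⟨ cong (k +_) (+-identityʳ (deg G v)) ⟨
      k + degSum G (v ∷ []) ∎
      where open ≤-Reasoning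
    walk-spectrum-bound intervals (cons {u} {w} {ps = ps} uw walk) {k} {k′} k∈ k′∈ = begin
      k′                          ≤⟨ walk-spectrum-bound intervals walk e∈w k′∈ ⟩
      e + degSum G ps             ≤⟨ +-monoˡ-≤ (degSum G ps) (spectrum-spread (intervals u) k∈ e∈u) ⟩
      k + deg G u + degSum G ps   ≡⟨ +-assoc k (deg G u) (degSum G ps) ⟩
      k + degSum G (u ∷ ps)       ∎
      where
      open ≤-Reasoning
      e : ℕ
      e = ecol c u w
      e∈u : InSpectrum G c u e
      e∈u = inj₂ (w , uw , refl)
      e∈w : InSpectrum G c w e
      e∈w = inj₂ (u , trans (sym G w u) uw , ecol-sym c w u)

theorem4 : (G : Graph) → Connected G → (t : ℕ) → HasIntervalTotalColouring G t →
    ∃[ u ] ∃[ v ] ∃[ ps ] (IsShortestPath G u v ps × t ≤ 1 + degSum G ps)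
theorem4 G conn t (1≤t , c , _ , _ , _ , _ , _ , used , intervals)
  with colourUsed⇒inSpectrum G c (used 1 ≤-refl 1≤t)
     | colourUsed⇒inSpectrum G c (used t 1≤t ≤-refl)
... | u , 1∈u | v , t∈v
  with connected⇒shortestPath G conn u v
... | ps , shortest@(walk , _) =
  u , v , ps , shortest , walk-spectrum-bound G c intervals walk 1∈u t∈v
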